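{- Let $\pi\in S_n$ and let $\omega=s_{i_1}\circ\cdots\circ s_{i_k}$ be a reduced expression for $\pi$. Then $\omega$ is the lexicographically first reduced expression for $\pi$ if and only if all of the following hold: (1) $\omega$ never has $s_j$ immediately followed by $s_i$ with $i<j-1$; (2) $\omega$ never has three consecutive factors $s_{i+1}\circ s_i\circ s_{i+1}$; (3) $\omega$ is not in the same commutation class as any reduced expression containing three consecutive factors $s_{i+1}\circ s_i\circ s_{i+1}$.
   Context: $s_i$ denotes the adjacent transposition $(i,i+1)$. A reduced expression is an expression of minimal length as a product of adjacent transpositions. The commutation class of a reduced expression is the set of reduced expressions obtained from it by repeatedly applying relations $s_i\circ s_j=s_j\circ s_i$ with $|i-j|>1$. The lexicographically first reduced expression for $\pi$ is the one whose word of indices $(i_1,\dots,i_k)$ is lexicographically smallest among all reduced expressions for $\pi$ (a word is smaller if it has the smaller letter at the first position where the two words differ). -}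

module Defs where

open import Data.Nat using (ℕ; zero; suc; _<_; _≤_)
open import Data.Nat.Properties using (_≟_)
open import Data.Fin using (Fin; toℕ)
open import Data.Fin.Permutation using (Permutation′; _⟨$⟩ʳ_)
open import Data.List using (List; []; _∷_; _++_; length)
open import Data.List.Relation.Unary.All using (All)
open import Data.Product using (Σ; _×_; _,_)
open import Data.Sum using (_⊎_)
open import Relation.Nullary using (¬_; yes; no)
open import Relation.Binary.PropositionalEquality using (_≡_)
open import Relation.Binary.Construct.Closure.ReflexiveTransitive using (Star)

-- Convention: points of {1..n} are encoded 0-indexed as 0..n-1, and the
-- paper's s_i (i = 1..n-1) is encoded as the letter i-1 (so letters are
-- 0..n-2).  A word is a List ℕ of letters.

swapAdj : ℕ → ℕ → ℕ
swapAdj i x with x ≟ i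
... | yes _ = suc i
... | no _ with x ≟ suc i
...   | yes _ = i
...   | no _  = x

-- evaluation of ω = s_{i1} ∘ ⋯ ∘ s_{ik} : rightmost factor acts first
eval : List ℕ → ℕ → ℕ
eval []      x = x
eval (i ∷ w) x = swapAdj i (eval w x)

ValidWord : ℕ → List ℕ → Set
ValidWord n w = All (λ i → suc i < n) w

Expresses : (n : ℕ) → Permutation′ n → List ℕ → Set
Expresses n π w = ValidWord n w × (∀ (x : Fin n) → toℕ (π ⟨$⟩ʳ x) ≡ eval w (toℕ x))

Reduced : (n : ℕ) → Permutation′ n → List ℕ → Set
Reduced n π w = Expresses n π w × (∀ v → Expresses n π v → length w ≤ length v)

data Lex≤ : List ℕ → List ℕ → Set where
  lex-[] : ∀ {v} → Lex≤ [] v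
  lex-<  : ∀ {x y xs ys} → x < y → Lex≤ (x ∷ xs) (y ∷ ys)
  lex-≡  : ∀ {x xs ys} → Lex≤ xs ys → Lex≤ (x ∷ xs) (x ∷ ys)

LexFirst : (n : ℕ) → Permutation′ n → List ℕ → Set
LexFirst n π w = Reduced n π w × (∀ v → Reduced n π v → Lex≤ w v)

data CommStep : List ℕ → List ℕ → Set where
  comm : ∀ xs a b ys → (suc a < b ⊎ suc b < a) →
         CommStep (xs ++ a ∷ b ∷ ys) (xs ++ b ∷ a ∷ ys)

CommEquiv : List ℕ → List ℕ → Set
CommEquiv = Star CommStep

Cond1 : List ℕ → Set
Cond1 w = ∀ xs j i ys → w ≡ xs ++ j ∷ i ∷ ys → ¬ (suc i < j)

HasBraid : List ℕ → Set
HasBraid w = Σ (List ℕ) λ xs → Σ ℕ λ i → Σ (List ℕ) λ ys →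
             w ≡ xs ++ suc i ∷ i ∷ suc i ∷ ys

Cond2 : List ℕ → Set
Cond2 w = ¬ HasBraid w

Cond3 : List ℕ → Set
Cond3 w = ∀ v → CommEquiv w v → ¬ HasBraid v

-- The lexicographically first reduced word of π is its canonical word, a product of descending
-- runs k₁ (k₁ - 1) … c₁ · k₂ … c₂ ⋯ with strictly increasing tops k₁ < k₂ < ⋯.  Lengths are
-- controlled by the number of inversions ℓ: prepending a letter changes ℓ by exactly one, so a
-- word is reduced iff its length is ℓ.  Prepending b < k₁ to the canonical word increases ℓ, so
-- if another reduced word b v of π began with b < k₁, then v would express a permutation with
-- ℓ(π) + 1 inversions using only ℓ(π) - 1 letters; hence the canonical word is lexicographically
-- least.
-- Conversely, scanning a word satisfying the three conditions from the left, every letter must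
-- either continue the current run downwards or start a new run above its top: a letter further
-- below violates (1), a repeated letter is not reduced, and a letter i+1 inside the run produces
-- s_{i+1} s_i R s_{i+1} with R below i, whose last factor commutes to the left into a braid,
-- violating (3).  A lexicographically first word satisfies the conditions, since a violation
-- yields a lexicographically smaller reduced word by one commutation or braid move.  Canonical
-- words satisfy (3) because, restricted to the letters a and a+1, they never have two
-- consecutive a's; commutations preserve this, while the braid (a) (a-1) (a) violates it.

module Submission where

open import Defs
open import Data.Nat using (ℕ; zero; suc; _<_; _≤_; _+_; z≤n; s≤s; _≟_; _<?_)
open import Data.Nat.Properties
open import Data.Fin using (toℕ; fromℕ<)
open import Data.Fin.Properties using (toℕ<n; toℕ-fromℕ<)
open import Data.Fin.Permutation using (Permutation′; _⟨$⟩ʳ_)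
open import Data.List using (List; []; _∷_; _++_; _∷ʳ_; length; reverse; applyDownFrom)
open import Data.List.Properties using (++-assoc; ∷ʳ-++; length-++; unfold-reverse)
open import Data.List.Relation.Unary.All as All using (All; []; _∷_)
open import Data.List.Relation.Unary.Linked as Linked using (Linked; []; [-]; _∷_)
open import Data.List.Relation.Unary.All.Properties using (++⁺; ++⁻; ∷ʳ⁺; applyDownFrom⁺₁)
open import Data.Product using (∃-syntax; _×_; _,_; proj₁; proj₂)
open import Data.Sum using (_⊎_; inj₁; inj₂)
open import Data.Empty using (⊥-elim)
open import Data.Bool using (Bool; true; false)
open import Data.Unit using (⊤; tt)
open import Function using (_∘_)
open import Function.Bundles using (_⇔_; mk⇔)
open import Relation.Nullary using (¬_; yes; no)
open import Relation.Nullary.Decidable using (_×-dec_)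
open import Relation.Binary.Definitions using (tri<; tri≈; tri>)
open import Relation.Binary.Construct.Closure.ReflexiveTransitive using (ε; _◅_; _◅◅_)
open import Relation.Binary.PropositionalEquality
open ≡-Reasoning

-- Adjacent transpositions

data SwapView (i x : ℕ) : Set where
  at-i     : x ≡ i → SwapView i x
  at-suc-i : x ≡ suc i → SwapView i x
  fixed    : x ≢ i → x ≢ suc i → SwapView i x

swapView : ∀ i x → SwapView i x
swapView i x with x ≟ i | x ≟ suc i
... | yes x≡i | _         = at-i x≡i
... | no _    | yes x≡1+i = at-suc-i x≡1+i
... | no x≢i  | no x≢1+i  = fixed x≢i x≢1+i

swapAdj-i : ∀ i → swapAdj i i ≡ suc i
swapAdj-i i with i ≟ i
... | yes _   = refl
... | no i≢i = ⊥-elim (i≢i refl)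

swapAdj-suc-i : ∀ i → swapAdj i (suc i) ≡ i
swapAdj-suc-i i with suc i ≟ i
... | yes 1+i≡i = ⊥-elim (1+n≢n 1+i≡i)
... | no _ with suc i ≟ suc i
...   | yes _       = refl
...   | no 1+i≢1+i = ⊥-elim (1+i≢1+i refl)

swapAdj-fixed : ∀ {i x} → x ≢ i → x ≢ suc i → swapAdj i x ≡ x
swapAdj-fixed {i} {x} x≢i x≢1+i with x ≟ i
... | yes x≡i = ⊥-elim (x≢i x≡i)
... | no _ with x ≟ suc i
...   | yes x≡1+i = ⊥-elim (x≢1+i x≡1+i)
...   | no _      = refl

swapAdj-below : ∀ {i x} → x < i → swapAdj i x ≡ x
swapAdj-below x<i = swapAdj-fixed (<⇒≢ x<i) (<⇒≢ (m<n⇒m<1+n x<i))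

swapAdj-above : ∀ {i x} → suc i < x → swapAdj i x ≡ x
swapAdj-above 1+i<x =
  swapAdj-fixed (≢-sym (<⇒≢ (<-trans (n<1+n _) 1+i<x))) (≢-sym (<⇒≢ 1+i<x))

swapAdj-involutive : ∀ i x → swapAdj i (swapAdj i x) ≡ x
swapAdj-involutive i x with swapView i x
... | at-i refl       rewrite swapAdj-i x = swapAdj-suc-i x
... | at-suc-i refl   rewrite swapAdj-suc-i i = swapAdj-i i
... | fixed x≢i x≢1+i rewrite swapAdj-fixed x≢i x≢1+i = swapAdj-fixed x≢i x≢1+i

swapAdj≡i⇒ : ∀ {i x} → swapAdj i x ≡ i → x ≡ suc i
swapAdj≡i⇒ {i} {x} eq = begin
  x                         ≡⟨ swapAdj-involutive i x ⟨
  swapAdj i (swapAdj i x)   ≡⟨ cong (swapAdj i) eq ⟩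
  swapAdj i i               ≡⟨ swapAdj-i i ⟩
  suc i                     ∎

swapAdj-comm : ∀ {a c} → suc a < c → ∀ x → swapAdj a (swapAdj c x) ≡ swapAdj c (swapAdj a x)
swapAdj-comm {a} {c} 1+a<c x with swapView c x
... | at-i refl = begin
  swapAdj a (swapAdj c c)   ≡⟨ cong (swapAdj a) (swapAdj-i c) ⟩
  swapAdj a (suc c)         ≡⟨ swapAdj-above (m<n⇒m<1+n 1+a<c) ⟩
  suc c                     ≡⟨ swapAdj-i c ⟨
  swapAdj c c               ≡⟨ cong (swapAdj c) (swapAdj-above 1+a<c) ⟨
  swapAdj c (swapAdj a c)   ∎
... | at-suc-i refl = begin
  swapAdj a (swapAdj c (suc c))   ≡⟨ cong (swapAdj a) (swapAdj-suc-i c) ⟩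
  swapAdj a c                     ≡⟨ swapAdj-above 1+a<c ⟩
  c                               ≡⟨ swapAdj-suc-i c ⟨
  swapAdj c (suc c)               ≡⟨ cong (swapAdj c) (swapAdj-above (m<n⇒m<1+n 1+a<c)) ⟨
  swapAdj c (swapAdj a (suc c))   ∎
... | fixed x≢c x≢1+c = begin
  swapAdj a (swapAdj c x)   ≡⟨ cong (swapAdj a) (swapAdj-fixed x≢c x≢1+c) ⟩
  swapAdj a x               ≡⟨ fixed-by-c (swapView a x) ⟨
  swapAdj c (swapAdj a x)   ∎
  where
  fixed-by-c : SwapView a x → swapAdj c (swapAdj a x) ≡ swapAdj a x
  fixed-by-c (at-i refl) =
    trans (cong (swapAdj c) (swapAdj-i a)) (trans (swapAdj-below 1+a<c) (sym (swapAdj-i a)))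
  fixed-by-c (at-suc-i refl) =
    trans (cong (swapAdj c) (swapAdj-suc-i a)) (trans (swapAdj-below (<-trans (n<1+n a) 1+a<c))
          (sym (swapAdj-suc-i a)))
  fixed-by-c (fixed x≢a x≢1+a) =
    trans (cong (swapAdj c) (swapAdj-fixed x≢a x≢1+a))
          (trans (swapAdj-fixed x≢c x≢1+c) (sym (swapAdj-fixed x≢a x≢1+a)))

Far : ℕ → ℕ → Set
Far x y = suc x < y ⊎ suc y < x

Far-sym : ∀ {x y} → Far x y → Far y x
Far-sym (inj₁ 1+x<y) = inj₂ 1+x<y
Far-sym (inj₂ 1+y<x) = inj₁ 1+y<x

Far⇒≢ : ∀ {x y} → Far x y → y ≢ x
Far⇒≢ (inj₁ 1+x<y) refl = 1+n≰n (<⇒≤ 1+x<y)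
Far⇒≢ (inj₂ 1+y<x) refl = 1+n≰n (<⇒≤ 1+y<x)

Far⇒≢suc : ∀ {x y} → Far x y → y ≢ suc x
Far⇒≢suc (inj₁ 1+x<y) refl = <-irrefl refl 1+x<y
Far⇒≢suc (inj₂ 2+x<x) refl = 1+n≰n (≤-trans (n≤1+n _) (<⇒≤ 2+x<x))

swapAdj-comm-far : ∀ {a c} → Far a c → ∀ x → swapAdj a (swapAdj c x) ≡ swapAdj c (swapAdj a x)
swapAdj-comm-far (inj₁ 1+a<c) x = swapAdj-comm 1+a<c x
swapAdj-comm-far (inj₂ 1+c<a) x = sym (swapAdj-comm 1+c<a x)

swapAdj-braid : ∀ i x → swapAdj (suc i) (swapAdj i (swapAdj (suc i) x))
                      ≡ swapAdj i (swapAdj (suc i) (swapAdj i x))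
swapAdj-braid i x with swapView (suc i) x
... | at-i refl = begin
  swapAdj (suc i) (swapAdj i (swapAdj (suc i) (suc i)))  ≡⟨ cong (swapAdj (suc i) ∘ swapAdj i) (swapAdj-i (suc i)) ⟩
  swapAdj (suc i) (swapAdj i (suc (suc i)))              ≡⟨ cong (swapAdj (suc i)) (swapAdj-above ≤-refl) ⟩
  swapAdj (suc i) (suc (suc i))                          ≡⟨ swapAdj-suc-i (suc i) ⟩
  suc i                                                  ≡⟨ swapAdj-i i ⟨
  swapAdj i i                                            ≡⟨ cong (swapAdj i) (swapAdj-below (n<1+n i)) ⟨
  swapAdj i (swapAdj (suc i) i)                          ≡⟨ cong (swapAdj i ∘ swapAdj (suc i)) (swapAdj-suc-i i) ⟨
  swapAdj i (swapAdj (suc i) (swapAdj i (suc i)))        ∎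
... | at-suc-i refl = begin
  swapAdj (suc i) (swapAdj i (swapAdj (suc i) (suc (suc i))))  ≡⟨ cong (swapAdj (suc i) ∘ swapAdj i) (swapAdj-suc-i (suc i)) ⟩
  swapAdj (suc i) (swapAdj i (suc i))                          ≡⟨ cong (swapAdj (suc i)) (swapAdj-suc-i i) ⟩
  swapAdj (suc i) i                                            ≡⟨ swapAdj-below (n<1+n i) ⟩
  i                                                            ≡⟨ swapAdj-suc-i i ⟨
  swapAdj i (suc i)                                            ≡⟨ cong (swapAdj i) (swapAdj-suc-i (suc i)) ⟨
  swapAdj i (swapAdj (suc i) (suc (suc i)))                    ≡⟨ cong (swapAdj i ∘ swapAdj (suc i)) (swapAdj-above ≤-refl) ⟨
  swapAdj i (swapAdj (suc i) (swapAdj i (suc (suc i))))        ∎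
... | fixed x≢1+i x≢2+i with swapView i x
...   | at-i refl = begin
  swapAdj (suc i) (swapAdj i (swapAdj (suc i) i))  ≡⟨ cong (swapAdj (suc i) ∘ swapAdj i) (swapAdj-below (n<1+n i)) ⟩
  swapAdj (suc i) (swapAdj i i)                    ≡⟨ cong (swapAdj (suc i)) (swapAdj-i i) ⟩
  swapAdj (suc i) (suc i)                          ≡⟨ swapAdj-i (suc i) ⟩
  suc (suc i)                                      ≡⟨ swapAdj-above ≤-refl ⟨
  swapAdj i (suc (suc i))                          ≡⟨ cong (swapAdj i) (swapAdj-i (suc i)) ⟨
  swapAdj i (swapAdj (suc i) (suc i))              ≡⟨ cong (swapAdj i ∘ swapAdj (suc i)) (swapAdj-i i) ⟨
  swapAdj i (swapAdj (suc i) (swapAdj i i))        ∎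
...   | at-suc-i x≡1+i = ⊥-elim (x≢1+i x≡1+i)
...   | fixed x≢i x≢1+i′ = begin
  swapAdj (suc i) (swapAdj i (swapAdj (suc i) x))  ≡⟨ cong (swapAdj (suc i) ∘ swapAdj i) fixed-by-1+i ⟩
  swapAdj (suc i) (swapAdj i x)                    ≡⟨ cong (swapAdj (suc i)) fixed-by-i ⟩
  swapAdj (suc i) x                                ≡⟨ fixed-by-1+i ⟩
  x                                                ≡⟨ fixed-by-i ⟨
  swapAdj i x                                      ≡⟨ cong (swapAdj i) fixed-by-1+i ⟨
  swapAdj i (swapAdj (suc i) x)                    ≡⟨ cong (swapAdj i ∘ swapAdj (suc i)) fixed-by-i ⟨
  swapAdj i (swapAdj (suc i) (swapAdj i x))        ∎
  where
  fixed-by-i : swapAdj i x ≡ x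
  fixed-by-i = swapAdj-fixed x≢i x≢1+i′
  fixed-by-1+i : swapAdj (suc i) x ≡ x
  fixed-by-1+i = swapAdj-fixed x≢1+i x≢2+i

swapAdj-mono : ∀ b {x y} → x < y → ¬ (x ≡ b × y ≡ suc b) → swapAdj b x < swapAdj b y
swapAdj-mono b {x} {y} x<y not-b,1+b with swapView b x | swapView b y
... | at-i refl | at-i refl = ⊥-elim (<-irrefl refl x<y)
... | at-i refl | at-suc-i refl = ⊥-elim (not-b,1+b (refl , refl))
... | at-i refl | fixed y≢b y≢1+b
  rewrite swapAdj-i x | swapAdj-fixed y≢b y≢1+b = ≤∧≢⇒< x<y (≢-sym y≢1+b)
... | at-suc-i refl | at-i refl = ⊥-elim (<-asym x<y (n<1+n b))
... | at-suc-i refl | at-suc-i refl = ⊥-elim (<-irrefl refl x<y)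
... | at-suc-i refl | fixed y≢b y≢1+b
  rewrite swapAdj-suc-i b | swapAdj-fixed y≢b y≢1+b = <-trans (n<1+n b) x<y
... | fixed x≢b x≢1+b | at-i refl
  rewrite swapAdj-i y | swapAdj-fixed x≢b x≢1+b = <-trans x<y (n<1+n y)
... | fixed x≢b x≢1+b | at-suc-i refl
  rewrite swapAdj-suc-i b | swapAdj-fixed x≢b x≢1+b = ≤∧≢⇒< (≤-pred x<y) x≢b
... | fixed x≢b x≢1+b | fixed y≢b y≢1+b
  rewrite swapAdj-fixed x≢b x≢1+b | swapAdj-fixed y≢b y≢1+b = x<y

swapAdj-bounded : ∀ {i n x} → suc i < n → x < n → swapAdj i x < n
swapAdj-bounded {i} {n} {x} 1+i<n x<n with swapView i x
... | at-i refl       rewrite swapAdj-i x = 1+i<n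
... | at-suc-i refl   rewrite swapAdj-suc-i i = <-trans (n<1+n i) 1+i<n
... | fixed x≢i x≢1+i rewrite swapAdj-fixed x≢i x≢1+i = x<n

swapAdj-≤ : ∀ {i x c} → x ≢ suc i → suc i ≤ c → x ≤ c → swapAdj i x ≤ c
swapAdj-≤ {i} {x} x≢1+i 1+i≤c x≤c with swapView i x
... | at-i refl        rewrite swapAdj-i x = 1+i≤c
... | at-suc-i x≡1+i   = ⊥-elim (x≢1+i x≡1+i)
... | fixed x≢i x≢1+i′ rewrite swapAdj-fixed x≢i x≢1+i′ = x≤c

eval-++ : ∀ u v x → eval (u ++ v) x ≡ eval u (eval v x)
eval-++ []      v x = refl
eval-++ (i ∷ u) v x = cong (swapAdj i) (eval-++ u v x)

eval-reverse-∷ : ∀ i w x → eval (reverse (i ∷ w)) x ≡ eval (reverse w) (swapAdj i x)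
eval-reverse-∷ i w x = begin
  eval (reverse (i ∷ w)) x       ≡⟨ cong (λ u → eval u x) (unfold-reverse i w) ⟩
  eval (reverse w ∷ʳ i) x        ≡⟨ eval-++ (reverse w) (i ∷ []) x ⟩
  eval (reverse w) (swapAdj i x) ∎

eval-reverse-eval : ∀ w x → eval (reverse w) (eval w x) ≡ x
eval-reverse-eval []      x = refl
eval-reverse-eval (i ∷ w) x = begin
  eval (reverse (i ∷ w)) (swapAdj i (eval w x))       ≡⟨ eval-reverse-∷ i w _ ⟩
  eval (reverse w) (swapAdj i (swapAdj i (eval w x))) ≡⟨ cong (eval (reverse w)) (swapAdj-involutive i _) ⟩
  eval (reverse w) (eval w x)                         ≡⟨ eval-reverse-eval w x ⟩
  x                                                   ∎

eval-eval-reverse : ∀ w x → eval w (eval (reverse w) x) ≡ x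
eval-eval-reverse []      x = refl
eval-eval-reverse (i ∷ w) x = begin
  swapAdj i (eval w (eval (reverse (i ∷ w)) x))       ≡⟨ cong (swapAdj i ∘ eval w) (eval-reverse-∷ i w x) ⟩
  swapAdj i (eval w (eval (reverse w) (swapAdj i x))) ≡⟨ cong (swapAdj i) (eval-eval-reverse w _) ⟩
  swapAdj i (swapAdj i x)                             ≡⟨ swapAdj-involutive i x ⟩
  x                                                   ∎

eval-injective : ∀ w {x y} → eval w x ≡ eval w y → x ≡ y
eval-injective w {x} {y} eq = begin
  x                           ≡⟨ eval-reverse-eval w x ⟨
  eval (reverse w) (eval w x) ≡⟨ cong (eval (reverse w)) eq ⟩
  eval (reverse w) (eval w y) ≡⟨ eval-reverse-eval w y ⟩
  y                           ∎

All-reverse : ∀ {P : ℕ → Set} {w} → All P w → All P (reverse w)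
All-reverse {w = []}    []         = []
All-reverse {w = i ∷ w} (pi ∷ pw) = subst (All _) (sym (unfold-reverse i w)) (∷ʳ⁺ (All-reverse pw) pi)

eval-bounded : ∀ {n w x} → ValidWord n w → x < n → eval w x < n
eval-bounded []          x<n = x<n
eval-bounded (1+i<n ∷ v) x<n = swapAdj-bounded 1+i<n (eval-bounded v x<n)

-- Inversions and reduced words

sumBelow : ℕ → (ℕ → ℕ) → ℕ
sumBelow zero    g = 0
sumBelow (suc m) g = g m + sumBelow m g

sumBelow-cong : ∀ m {g h} → (∀ {x} → x < m → g x ≡ h x) → sumBelow m g ≡ sumBelow m h
sumBelow-cong zero    eq = refl
sumBelow-cong (suc m) eq = cong₂ _+_ (eq ≤-refl) (sumBelow-cong m (eq ∘ m<n⇒m<1+n))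

sumBelow-zero : ∀ m {g} → (∀ {x} → x < m → g x ≡ 0) → sumBelow m g ≡ 0
sumBelow-zero zero    eq = refl
sumBelow-zero (suc m) eq = cong₂ _+_ (eq ≤-refl) (sumBelow-zero m (eq ∘ m<n⇒m<1+n))

sumBelow-suc : ∀ m {g h p} → p < m → (∀ {x} → x < m → x ≢ p → h x ≡ g x) → h p ≡ suc (g p) →
               sumBelow m h ≡ suc (sumBelow m g)
sumBelow-suc (suc m) {g} {h} {p} p<1+m eq eq-p with m ≟ p
... | yes refl =
  cong₂ _+_ eq-p (sumBelow-cong m (λ x<m → eq (m<n⇒m<1+n x<m) (<⇒≢ x<m)))
... | no m≢p = begin
  h m + sumBelow m h       ≡⟨ cong₂ _+_ (eq ≤-refl m≢p) (sumBelow-suc m p<m (eq ∘ m<n⇒m<1+n) eq-p) ⟩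
  g m + suc (sumBelow m g) ≡⟨ +-suc (g m) _ ⟩
  suc (g m + sumBelow m g) ∎
  where
  p<m : p < m
  p<m = ≤∧≢⇒< (≤-pred p<1+m) (≢-sym m≢p)

inverted : ℕ → ℕ → ℕ
inverted u v with v <? u
... | yes _ = 1
... | no  _ = 0

inverted-yes : ∀ {u v} → v < u → inverted u v ≡ 1
inverted-yes {u} {v} v<u with v <? u
... | yes _  = refl
... | no v≮u = ⊥-elim (v≮u v<u)

inverted-no : ∀ {u v} → ¬ v < u → inverted u v ≡ 0
inverted-no {u} {v} v≮u with v <? u
... | yes v<u = ⊥-elim (v≮u v<u)
... | no _    = refl

inverted-swapAdj : ∀ b {u v} → ¬ (u ≡ b × v ≡ suc b) → ¬ (v ≡ b × u ≡ suc b) →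
                   inverted (swapAdj b u) (swapAdj b v) ≡ inverted u v
inverted-swapAdj b {u} {v} ¬u,v ¬v,u with <-cmp u v
... | tri< u<v _ _ =
  trans (inverted-no (<-asym (swapAdj-mono b u<v ¬u,v))) (sym (inverted-no (<-asym u<v)))
... | tri≈ _ refl _ = trans (inverted-no (<-irrefl refl)) (sym (inverted-no (<-irrefl refl)))
... | tri> _ _ v<u = trans (inverted-yes (swapAdj-mono b v<u ¬v,u)) (sym (inverted-yes v<u))

inversions : ℕ → (ℕ → ℕ) → ℕ
inversions n f = sumBelow n (λ y → sumBelow y (λ x → inverted (f x) (f y)))

inversions-cong : ∀ n {f g} → (∀ {x} → x < n → f x ≡ g x) → inversions n f ≡ inversions n g
inversions-cong n eq = sumBelow-cong n (λ y<n → sumBelow-cong _ (λ x<y →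
  cong₂ inverted (eq (<-trans x<y y<n)) (eq y<n)))

inversions-swapAdj : ∀ {n f b p q} → (∀ {x y} → f x ≡ f y → x ≡ y) →
                     p < q → q < n → f p ≡ b → f q ≡ suc b →
                     inversions n (swapAdj b ∘ f) ≡ suc (inversions n f)
inversions-swapAdj {n} {f} {b} {p} {q} f-inj p<q q<n fp≡b fq≡1+b =
  sumBelow-suc n q<n
    (λ y<n y≢q → sumBelow-cong _ (λ x<y → other-pair x<y (y≢q ∘ proj₂)))
    (sumBelow-suc q p<q (λ x<q x≢p → other-pair x<q (x≢p ∘ proj₁)) pair-p,q)
  where
  other-pair : ∀ {x y} → x < y → ¬ (x ≡ p × y ≡ q) →
               inverted (swapAdj b (f x)) (swapAdj b (f y)) ≡ inverted (f x) (f y)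
  other-pair x<y ¬p,q = inverted-swapAdj b
    (λ (fx≡b , fy≡1+b) → ¬p,q (f-inj (trans fx≡b (sym fp≡b)) , f-inj (trans fy≡1+b (sym fq≡1+b))))
    (λ (fy≡b , fx≡1+b) → <-asym p<q (subst₂ _<_ (f-inj (trans fx≡1+b (sym fq≡1+b)))
                                                (f-inj (trans fy≡b (sym fp≡b))) x<y))
  pair-p,q : inverted (swapAdj b (f p)) (swapAdj b (f q)) ≡ suc (inverted (f p) (f q))
  pair-p,q = begin
    inverted (swapAdj b (f p)) (swapAdj b (f q)) ≡⟨ cong₂ (λ u v → inverted (swapAdj b u) (swapAdj b v)) fp≡b fq≡1+b ⟩
    inverted (swapAdj b b) (swapAdj b (suc b))   ≡⟨ cong₂ inverted (swapAdj-i b) (swapAdj-suc-i b) ⟩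
    inverted (suc b) b                           ≡⟨ inverted-yes (n<1+n b) ⟩
    1                                            ≡⟨ cong suc (inverted-no (<-asym (n<1+n b))) ⟨
    suc (inverted b (suc b))                     ≡⟨ cong (suc ∘ inverted b) fq≡1+b ⟨
    suc (inverted b (f q))                       ≡⟨ cong (λ u → suc (inverted u (f q))) fp≡b ⟨
    suc (inverted (f p) (f q))                   ∎

SamePerm : ℕ → List ℕ → List ℕ → Set
SamePerm n u v = ∀ {x} → x < n → eval u x ≡ eval v x

SamePerm-∷ : ∀ {n} u v b → SamePerm n (b ∷ u) v → SamePerm n u (b ∷ v)
SamePerm-∷ u v b same {x} x<n =
  trans (sym (swapAdj-involutive b (eval u x))) (cong (swapAdj b) (same x<n))

ℓ : ℕ → List ℕ → ℕ
ℓ n w = inversions n (eval w)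

ℓ-[] : ∀ n → ℓ n [] ≡ 0
ℓ-[] n = sumBelow-zero n (λ {y} _ → sumBelow-zero y (λ x<y → inverted-no (<-asym x<y)))

ℓ-cong : ∀ {n} u v → SamePerm n u v → ℓ n u ≡ ℓ n v
ℓ-cong {n} _ _ = inversions-cong n

ℓ-∷-ascent : ∀ {n w b} → ValidWord n w → suc b < n →
             eval (reverse w) b < eval (reverse w) (suc b) → ℓ n (b ∷ w) ≡ suc (ℓ n w)
ℓ-∷-ascent {w = w} {b} valid 1+b<n ascent =
  inversions-swapAdj (eval-injective w) ascent (eval-bounded (All-reverse valid) 1+b<n)
                     (eval-eval-reverse w b) (eval-eval-reverse w (suc b))

ℓ-∷-descent : ∀ {n w b} → ValidWord n w → suc b < n →
              eval (reverse w) (suc b) < eval (reverse w) b → ℓ n w ≡ suc (ℓ n (b ∷ w))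
ℓ-∷-descent {n} {w} {b} valid 1+b<n descent = begin
  ℓ n w           ≡⟨ ℓ-cong {n} (b ∷ b ∷ w) w (λ {x} _ → swapAdj-involutive b (eval w x)) ⟨
  ℓ n (b ∷ b ∷ w) ≡⟨ ℓ-∷-ascent (1+b<n ∷ valid) 1+b<n (subst₂ _<_ (sym h′-b) (sym h′-1+b) descent) ⟩
  suc (ℓ n (b ∷ w)) ∎
  where
  h′-b : eval (reverse (b ∷ w)) b ≡ eval (reverse w) (suc b)
  h′-b = trans (eval-reverse-∷ b w b) (cong (eval (reverse w)) (swapAdj-i b))
  h′-1+b : eval (reverse (b ∷ w)) (suc b) ≡ eval (reverse w) b
  h′-1+b = trans (eval-reverse-∷ b w (suc b)) (cong (eval (reverse w)) (swapAdj-suc-i b))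

ℓ-∷-≤ : ∀ {n w b} → ValidWord n w → suc b < n → ℓ n (b ∷ w) ≤ suc (ℓ n w)
ℓ-∷-≤ {n} {w} {b} valid 1+b<n with <-cmp (eval (reverse w) b) (eval (reverse w) (suc b))
... | tri< ascent _ _ = ≤-reflexive (ℓ-∷-ascent valid 1+b<n ascent)
... | tri≈ _ h-b≡h-1+b _ = ⊥-elim (1+n≢n (sym (eval-injective (reverse w) h-b≡h-1+b)))
... | tri> _ _ descent =
  ≤-trans (m≤n⇒m≤1+n (n≤1+n _)) (≤-reflexive (cong suc (sym (ℓ-∷-descent valid 1+b<n descent))))

ℓ≤length : ∀ {n w} → ValidWord n w → ℓ n w ≤ length w
ℓ≤length {n} []              = ≤-reflexive (ℓ-[] n)
ℓ≤length (1+b<n ∷ valid) = ≤-trans (ℓ-∷-≤ valid 1+b<n) (s≤s (ℓ≤length valid))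

module _ {n} (h : ℕ → ℕ) (h-bounded : ∀ {x} → x < n → h x < n)
         (h-ascending : ∀ {x} → suc x < n → h x < h (suc x)) where

  private
    ≤-image : ∀ x → x < n → x ≤ h x
    ≤-image zero    _     = z≤n
    ≤-image (suc x) 1+x<n = ≤-<-trans (≤-image x (<-trans (n<1+n x) 1+x<n)) (h-ascending 1+x<n)

    image-≤ : ∀ d x → suc x + d ≡ n → h x ≤ x
    image-≤ zero    x x+1≡n = ≤-pred (subst (h x <_) (sym x+1≡n′) (h-bounded (subst (x <_) x+1≡n′ ≤-refl)))
      where
      x+1≡n′ : suc x ≡ n
      x+1≡n′ = trans (cong suc (sym (+-identityʳ x))) x+1≡n
    image-≤ (suc d) x x+d+2≡n = ≤-pred (<-≤-trans (h-ascending 1+x<n) (image-≤ d (suc x) x+d+2≡n′))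
      where
      x+d+2≡n′ : suc (suc x) + d ≡ n
      x+d+2≡n′ = trans (cong suc (sym (+-suc x d))) x+d+2≡n
      1+x<n : suc x < n
      1+x<n = subst (suc x <_) x+d+2≡n′ (s≤s (s≤s (m≤m+n x d)))

  ascending⇒identity : ∀ {x} → x < n → h x ≡ x
  ascending⇒identity {x} x<n with m≤n⇒∃[o]m+o≡n x<n
  ... | d , x+1+d≡n = ≤-antisym (image-≤ d x x+1+d≡n) (≤-image x x<n)

ℓ-realised : ∀ {n w} → ValidWord n w → ∃[ v ] ValidWord n v × SamePerm n v w × length v ≡ ℓ n w
ℓ-realised {n} valid-w = realise _ valid-w refl
  where
  realise : ∀ m {w} → ValidWord n w → ℓ n w ≡ m → ∃[ v ] ValidWord n v × SamePerm n v w × length v ≡ m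
  realise m {w} valid ℓw≡m
    with anyUpTo? (λ b → suc b <? n ×-dec eval (reverse w) (suc b) <? eval (reverse w) b) n
  ... | yes (b , _ , 1+b<n , descent) with ℓ-∷-descent valid 1+b<n descent | m
  ...   | ℓw≡1+ℓbw | zero  = ⊥-elim (1+n≢0 (trans (sym ℓw≡1+ℓbw) ℓw≡m))
  ...   | ℓw≡1+ℓbw | suc m′ with realise m′ (1+b<n ∷ valid) (suc-injective (trans (sym ℓw≡1+ℓbw) ℓw≡m))
  ...     | v , valid-v , v≈bw , |v|≡m′ =
    b ∷ v , 1+b<n ∷ valid-v ,
    (λ {x} x<n → trans (cong (swapAdj b) (v≈bw x<n)) (swapAdj-involutive b (eval w x))) ,
    cong suc |v|≡m′
  realise m {w} valid ℓw≡m | no no-descent =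
    [] , [] , w-identity , trans (sym (ℓ-[] n)) (trans (ℓ-cong [] w w-identity) ℓw≡m)
    where
    h-ascending : ∀ {x} → suc x < n → eval (reverse w) x < eval (reverse w) (suc x)
    h-ascending {x} 1+x<n =
      ≤∧≢⇒< (≮⇒≥ (λ descent → no-descent (x , <-trans (n<1+n x) 1+x<n , 1+x<n , descent)))
            (λ h-x≡h-1+x → 1+n≢n (sym (eval-injective (reverse w) h-x≡h-1+x)))
    w-identity : SamePerm n [] w
    w-identity {x} x<n = begin
      x                             ≡⟨ eval-eval-reverse w x ⟨
      eval w (eval (reverse w) x)   ≡⟨ cong (eval w) (ascending⇒identity (eval (reverse w))
                                          (eval-bounded (All-reverse valid)) h-ascending x<n) ⟩
      eval w x                      ∎

IsReduced : ℕ → List ℕ → Set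
IsReduced n w = ValidWord n w × length w ≡ ℓ n w

isReduced-tail : ∀ {n b v} → IsReduced n (b ∷ v) → IsReduced n v
isReduced-tail (1+b<n ∷ valid , |bv|≡ℓbv) =
  valid , ≤-antisym (≤-pred (≤-trans (≤-reflexive |bv|≡ℓbv) (ℓ-∷-≤ valid 1+b<n))) (ℓ≤length valid)

HasSquare : List ℕ → Set
HasSquare w = ∃[ xs ] ∃[ j ] ∃[ ys ] w ≡ xs ++ j ∷ j ∷ ys

module _ {n : ℕ} {π : Permutation′ n} where

  expresses⇒SamePerm : ∀ {u v} → Expresses n π u → Expresses n π v → SamePerm n u v
  expresses⇒SamePerm {u} {v} (_ , π≡u) (_ , π≡v) x<n =
    subst (λ x → eval u x ≡ eval v x) (toℕ-fromℕ< x<n)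
          (trans (sym (π≡u (fromℕ< x<n))) (π≡v (fromℕ< x<n)))

  reduced⇒isReduced : ∀ {w} → Reduced n π w → IsReduced n w
  reduced⇒isReduced {w} ((valid , π≡w) , minimal) with ℓ-realised valid
  ... | v , valid-v , v≈w , |v|≡ℓw =
    valid , ≤-antisym (≤-trans (minimal v (valid-v , π≡v)) (≤-reflexive |v|≡ℓw)) (ℓ≤length valid)
    where
    π≡v : ∀ x → toℕ (π ⟨$⟩ʳ x) ≡ eval v (toℕ x)
    π≡v x = trans (π≡w x) (sym (v≈w (toℕ<n x)))

  expresses-replace-suffix : ∀ xs u v → Expresses n π (xs ++ u) →
                             (ValidWord n u → ValidWord n v) → (∀ z → eval u z ≡ eval v z) →
                             Expresses n π (xs ++ v)
  expresses-replace-suffix xs u v (valid , π≡xsu) valid-v u≈v =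
    ++⁺ (proj₁ (++⁻ xs valid)) (valid-v (proj₂ (++⁻ xs valid))) , π≡xsv
    where
    π≡xsv : ∀ x → toℕ (π ⟨$⟩ʳ x) ≡ eval (xs ++ v) (toℕ x)
    π≡xsv x = begin
      toℕ (π ⟨$⟩ʳ x)            ≡⟨ π≡xsu x ⟩
      eval (xs ++ u) (toℕ x)    ≡⟨ eval-++ xs u _ ⟩
      eval xs (eval u (toℕ x))  ≡⟨ cong (eval xs) (u≈v _) ⟩
      eval xs (eval v (toℕ x))  ≡⟨ eval-++ xs v _ ⟨
      eval (xs ++ v) (toℕ x)    ∎

  reduced-replace-suffix : ∀ xs u v → Reduced n π (xs ++ u) →
                           (ValidWord n u → ValidWord n v) → (∀ z → eval u z ≡ eval v z) →
                           length u ≡ length v → Reduced n π (xs ++ v)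
  reduced-replace-suffix xs u v (expresses , minimal) valid-v u≈v |u|≡|v| =
    expresses-replace-suffix xs u v expresses valid-v u≈v ,
    λ t π≡t → ≤-trans (≤-reflexive |xsv|≡|xsu|) (minimal t π≡t)
    where
    |xsv|≡|xsu| : length (xs ++ v) ≡ length (xs ++ u)
    |xsv|≡|xsu| = begin
      length (xs ++ v)      ≡⟨ length-++ xs ⟩
      length xs + length v  ≡⟨ cong (length xs +_) |u|≡|v| ⟨
      length xs + length u  ≡⟨ length-++ xs ⟨
      length (xs ++ u)      ∎

  reduced⇒¬HasSquare : ∀ {w} → Reduced n π w → ¬ HasSquare w
  reduced⇒¬HasSquare (expresses , minimal) (xs , j , ys , refl) =
    1+n≰n (≤-trans (n≤1+n _) (+-cancelˡ-≤ (length xs) _ _ |xsjjys|≤|xsys|))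
    where
    |xsjjys|≤|xsys| : length xs + suc (suc (length ys)) ≤ length xs + length ys
    |xsjjys|≤|xsys| = subst₂ _≤_ (length-++ xs) (length-++ xs)
      (minimal (xs ++ ys) (expresses-replace-suffix xs (j ∷ j ∷ ys) ys expresses
        (λ { (_ ∷ _ ∷ valid-ys) → valid-ys }) (λ z → swapAdj-involutive j (eval ys z))))

-- Canonical words

-- RunForm lo j w: w continues a product of descending runs whose last letter so far is j (so j - 1
-- would continue the run) and in which every new run must start at a letter ≥ lo.
data RunForm : ℕ → ℕ → List ℕ → Set where
  []       : ∀ {lo j} → RunForm lo j []
  continue : ∀ {lo j w} → RunForm lo j w → RunForm lo (suc j) (j ∷ w)
  newRun   : ∀ {lo j b w} → lo ≤ b → RunForm (suc b) b w → RunForm lo j (b ∷ w)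

Canonical : List ℕ → Set
Canonical = RunForm 0 0

runForm-weaken : ∀ {lo lo′ j w} → lo′ ≤ lo → RunForm lo j w → RunForm lo′ j w
runForm-weaken lo′≤lo []                 = []
runForm-weaken lo′≤lo (continue form)    = continue (runForm-weaken lo′≤lo form)
runForm-weaken lo′≤lo (newRun lo≤b form) = newRun (≤-trans lo′≤lo lo≤b) form

canonical-tail : ∀ {k u} → Canonical (k ∷ u) → Canonical u
canonical-tail (newRun _ [])              = []
canonical-tail (newRun _ (continue form)) = newRun z≤n (runForm-weaken (n≤1+n _) form)
canonical-tail (newRun _ (newRun _ form)) = newRun z≤n form

runForm-inverse-ascending : ∀ {lo j w} → RunForm lo j w → j ≤ lo →
                            ∀ {x y} → x < y → y ≤ lo → x ≢ j → y ≢ j →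
                            eval (reverse w) x < eval (reverse w) y
runForm-inverse-ascending [] _ x<y _ _ _ = x<y
runForm-inverse-ascending {lo} {suc j} {j ∷ w} (continue form) 1+j≤lo {x} {y} x<y y≤lo x≢1+j y≢1+j =
  subst₂ _<_ (sym (eval-reverse-∷ j w x)) (sym (eval-reverse-∷ j w y))
    (runForm-inverse-ascending form (≤-trans (n≤1+n j) 1+j≤lo)
      (swapAdj-mono j x<y (y≢1+j ∘ proj₂)) (swapAdj-≤ y≢1+j 1+j≤lo y≤lo)
      (x≢1+j ∘ swapAdj≡i⇒) (y≢1+j ∘ swapAdj≡i⇒))
runForm-inverse-ascending {lo} {j} {b ∷ w} (newRun lo≤b form) _ {x} {y} x<y y≤lo _ _ =
  subst₂ _<_ (sym (eval-reverse-∷ b w x)) (sym (eval-reverse-∷ b w y))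
    (runForm-inverse-ascending form (n≤1+n b)
      (swapAdj-mono b x<y (y≢1+b ∘ proj₂)) (swapAdj-≤ y≢1+b ≤-refl (m≤n⇒m≤1+n y≤b))
      (x≢1+b ∘ swapAdj≡i⇒) (y≢1+b ∘ swapAdj≡i⇒))
  where
  y≤b : y ≤ b
  y≤b = ≤-trans y≤lo lo≤b
  y≢1+b : y ≢ suc b
  y≢1+b refl = 1+n≰n y≤b
  x≢1+b : x ≢ suc b
  x≢1+b refl = 1+n≰n (≤-trans (<⇒≤ x<y) y≤b)

runForm-head-ascent : ∀ {k u b} → RunForm (suc k) k u → b < k →
                      eval (reverse (k ∷ u)) b < eval (reverse (k ∷ u)) (suc b)
runForm-head-ascent {k} {u} {b} form b<k =
  subst₂ _<_ (sym (eval-reverse-∷ k u b)) (sym (eval-reverse-∷ k u (suc b)))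
    (runForm-inverse-ascending form (n≤1+n k)
      (swapAdj-mono k (n<1+n b) (<⇒≢ b<k ∘ proj₁))
      (swapAdj-≤ (<⇒≢ b<k ∘ suc-injective) ≤-refl (s≤s (<⇒≤ b<k)))
      (λ eq → <-asym b<k (subst (k <_) (sym (swapAdj≡i⇒ eq)) (n<1+n k)))
      (λ eq → <⇒≢ b<k (suc-injective (swapAdj≡i⇒ eq))))

runForm-head-least : ∀ {n k u b v} → RunForm (suc k) k u → IsReduced n (k ∷ u) → IsReduced n (b ∷ v) →
                     SamePerm n (k ∷ u) (b ∷ v) → ¬ b < k
runForm-head-least {n} {k} {u} {b} {v} form (1+k<n ∷ valid-u , |ku|≡ℓku) (1+b<n ∷ valid-v , |bv|≡ℓbv) ku≈bv b<k =
  1+n≰n (≤-trans (n≤1+n _) (subst₂ _≤_ ℓv≡2+|u| |v|≡|u| (ℓ≤length valid-v)))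
  where
  v≈bku : SamePerm n v (b ∷ k ∷ u)
  v≈bku = SamePerm-∷ v (k ∷ u) b (λ x<n → sym (ku≈bv x<n))
  ℓv≡2+|u| : ℓ n v ≡ suc (suc (length u))
  ℓv≡2+|u| = begin
    ℓ n v               ≡⟨ ℓ-cong v (b ∷ k ∷ u) v≈bku ⟩
    ℓ n (b ∷ k ∷ u)     ≡⟨ ℓ-∷-ascent (1+k<n ∷ valid-u) 1+b<n (runForm-head-ascent form b<k) ⟩
    suc (ℓ n (k ∷ u))   ≡⟨ cong suc |ku|≡ℓku ⟨
    suc (length (k ∷ u)) ∎
  |v|≡|u| : length v ≡ length u
  |v|≡|u| = suc-injective (trans |bv|≡ℓbv (trans (sym (ℓ-cong (k ∷ u) (b ∷ v) ku≈bv)) (sym |ku|≡ℓku)))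

canonical⇒lex≤ : ∀ {n u v} → Canonical u → IsReduced n u → IsReduced n v → SamePerm n u v → Lex≤ u v
canonical⇒lex≤ {u = []} _ _ _ _ = lex-[]
canonical⇒lex≤ {n} {k ∷ u} {[]} _ (_ , |ku|≡ℓku) _ ku≈[] =
  ⊥-elim (1+n≢0 (trans |ku|≡ℓku (trans (ℓ-cong (k ∷ u) [] ku≈[]) (ℓ-[] n))))
canonical⇒lex≤ {n} {k ∷ u} {b ∷ v} canonical@(newRun _ form) red-ku red-bv ku≈bv with <-cmp b k
... | tri< b<k _ _ = ⊥-elim (runForm-head-least form red-ku red-bv ku≈bv b<k)
... | tri≈ _ refl _ = lex-≡ (canonical⇒lex≤ (canonical-tail canonical)
                                (isReduced-tail red-ku) (isReduced-tail red-bv) u≈v)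
  where
  u≈v : SamePerm n u v
  u≈v {x} x<n = trans (SamePerm-∷ u (k ∷ v) k ku≈bv x<n) (swapAdj-involutive k (eval v x))
... | tri> _ _ k<b = lex-< k<b

Linked-adjacent : ∀ {A : Set} {R : A → A → Set} xs {x y ys} → Linked R (xs ++ x ∷ y ∷ ys) → R x y
Linked-adjacent []       (Rxy ∷ _) = Rxy
Linked-adjacent (_ ∷ xs) linked    = Linked-adjacent xs (Linked.tail linked)

NoFarDescent : ℕ → ℕ → Set
NoFarDescent j i = ¬ (suc i < j)

runForm⇒linked : ∀ {lo p w} → RunForm lo p w → p ≤ lo → Linked NoFarDescent (p ∷ w)
runForm⇒linked []                  _    = [-]
runForm⇒linked (continue form)     p≤lo = <-irrefl refl ∷ runForm⇒linked form (≤-trans (n≤1+n _) p≤lo)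
runForm⇒linked (newRun lo≤b form) p≤lo =
  (λ 1+b<p → 1+n≰n (≤-trans 1+b<p (≤-trans p≤lo (≤-trans lo≤b (n≤1+n _))))) ∷ runForm⇒linked form (n≤1+n _)

canonical⇒Cond1 : ∀ {w} → Canonical w → Cond1 w
canonical⇒Cond1 canonical xs j i ys refl = Linked-adjacent xs (linked canonical)
  where
  linked : ∀ {w} → Canonical w → Linked NoFarDescent w
  linked []              = []
  linked (newRun _ form) = runForm⇒linked form (n≤1+n _)

-- Alternating a false w: among the letters a and suc a of w, no two a's are adjacent; the flag
-- records whether the previous such letter was a.
data Alternating (a : ℕ) : Bool → List ℕ → Set where
  []    : ∀ {afterA} → Alternating a afterA []
  low   : ∀ {w} → Alternating a true w → Alternating a false (a ∷ w)
  high  : ∀ {afterA w} → Alternating a false w → Alternating a afterA (suc a ∷ w)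
  other : ∀ {afterA x w} → x ≢ a → x ≢ suc a → Alternating a afterA w → Alternating a afterA (x ∷ w)

-- After an a the current run is either below a or still has to pass suc a, and every later run
-- starts above a; either way suc a is written before the next a.
RunSafe : ℕ → Bool → ℕ → ℕ → Set
RunSafe a true  lo j = suc a ≤ lo × (j ≤ a ⊎ suc (suc a) ≤ j)
RunSafe a false lo j = ⊤

runForm⇒alternating : ∀ a {lo j w} afterA → RunForm lo j w → j ≤ lo → RunSafe a afterA lo j →
                      Alternating a afterA w
continue⇒alternating : ∀ a {lo x w} afterA → RunForm lo x w → suc x ≤ lo → RunSafe a afterA lo (suc x) →
                       Alternating a afterA (x ∷ w)
newRun⇒alternating : ∀ a {lo j b w} afterA → lo ≤ b → RunForm (suc b) b w → RunSafe a afterA lo j →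
                     Alternating a afterA (b ∷ w)

runForm⇒alternating a afterA []                 _   _    = []
runForm⇒alternating a afterA (continue form)    j≤lo safe = continue⇒alternating a afterA form j≤lo safe
runForm⇒alternating a afterA (newRun lo≤b form) _   safe = newRun⇒alternating a afterA lo≤b form safe

continue⇒alternating a {x = x} afterA form 1+x≤lo safe with x ≟ a | x ≟ suc a
continue⇒alternating a true  form _ (_ , inj₁ 1+a≤a)   | yes refl | _ = ⊥-elim (1+n≰n 1+a≤a)
continue⇒alternating a true  form _ (_ , inj₂ 2+a≤1+a) | yes refl | _ = ⊥-elim (1+n≰n (≤-pred 2+a≤1+a))
continue⇒alternating a false form 1+a≤lo _ | yes refl | _ =
  low (runForm⇒alternating a true form (≤-trans (n≤1+n _) 1+a≤lo) (1+a≤lo , inj₁ ≤-refl))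
continue⇒alternating a afterA form 1+x≤lo _ | no _ | yes refl =
  high (runForm⇒alternating a false form (≤-trans (n≤1+n _) 1+x≤lo) tt)
continue⇒alternating a false form 1+x≤lo _ | no x≢a | no x≢1+a =
  other x≢a x≢1+a (runForm⇒alternating a false form (≤-trans (n≤1+n _) 1+x≤lo) tt)
continue⇒alternating a {x = x} true form 1+x≤lo (1+a≤lo , j-safe) | no x≢a | no x≢1+a =
  other x≢a x≢1+a (runForm⇒alternating a true form (≤-trans (n≤1+n _) 1+x≤lo) (1+a≤lo , x-safe j-safe))
  where
  x-safe : suc x ≤ a ⊎ suc (suc a) ≤ suc x → x ≤ a ⊎ suc (suc a) ≤ x
  x-safe (inj₁ 1+x≤a)   = inj₁ (≤-trans (n≤1+n _) 1+x≤a)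
  x-safe (inj₂ 2+a≤1+x) = inj₂ (≤∧≢⇒< (≤-pred 2+a≤1+x) (≢-sym x≢1+a))

newRun⇒alternating a {b = b} afterA lo≤b form safe with b ≟ a | b ≟ suc a
newRun⇒alternating a true lo≤b form (1+a≤lo , _) | yes refl | _ = ⊥-elim (1+n≰n (≤-trans 1+a≤lo lo≤b))
newRun⇒alternating a false lo≤b form _ | yes refl | _ =
  low (runForm⇒alternating a true form (n≤1+n _) (≤-refl , inj₁ ≤-refl))
newRun⇒alternating a afterA lo≤b form _ | no _ | yes refl =
  high (runForm⇒alternating a false form (n≤1+n _) tt)
newRun⇒alternating a false lo≤b form _ | no b≢a | no b≢1+a =
  other b≢a b≢1+a (runForm⇒alternating a false form (n≤1+n _) tt)
newRun⇒alternating a {b = b} true lo≤b form (1+a≤lo , _) | no b≢a | no b≢1+a =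
  other b≢a b≢1+a (runForm⇒alternating a true form (n≤1+n _)
    (≤-trans 1+a≤b (n≤1+n _) , inj₂ (≤∧≢⇒< 1+a≤b (≢-sym b≢1+a))))
  where
  1+a≤b : suc a ≤ b
  1+a≤b = ≤-trans 1+a≤lo lo≤b

alternating-swap : ∀ {a afterA x y ys} → Far x y → Alternating a afterA (x ∷ y ∷ ys) →
                   Alternating a afterA (y ∷ x ∷ ys)
alternating-swap far (low (high _))                 = ⊥-elim (Far⇒≢suc far refl)
alternating-swap far (low (other y≢a y≢1+a w))      = other y≢a y≢1+a (low w)
alternating-swap far (high (low _))                 = ⊥-elim (Far⇒≢suc (Far-sym far) refl)
alternating-swap far (high (high _))                = ⊥-elim (Far⇒≢ far refl)
alternating-swap far (high (other y≢a y≢1+a w))     = other y≢a y≢1+a (high w)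
alternating-swap far (other x≢a x≢1+a (low w))      = low (other x≢a x≢1+a w)
alternating-swap far (other x≢a x≢1+a (high w))     = high (other x≢a x≢1+a w)
alternating-swap far (other x≢a x≢1+a (other y≢a y≢1+a w)) = other y≢a y≢1+a (other x≢a x≢1+a w)

alternating-CommStep : ∀ {a afterA u v} → CommStep u v → Alternating a afterA u → Alternating a afterA v
alternating-CommStep (comm [] x y ys far) w = alternating-swap far w
alternating-CommStep (comm (_ ∷ xs) x y ys far) (low w)  = low (alternating-CommStep (comm xs x y ys far) w)
alternating-CommStep (comm (_ ∷ xs) x y ys far) (high w) = high (alternating-CommStep (comm xs x y ys far) w)
alternating-CommStep (comm (_ ∷ xs) x y ys far) (other z≢a z≢1+a w) =
  other z≢a z≢1+a (alternating-CommStep (comm xs x y ys far) w)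

alternating-CommEquiv : ∀ {a afterA u v} → CommEquiv u v → Alternating a afterA u → Alternating a afterA v
alternating-CommEquiv ε                w = w
alternating-CommEquiv (step ◅ steps) w = alternating-CommEquiv steps (alternating-CommStep step w)

alternating⇒¬braid : ∀ {afterA} i xs ys → ¬ Alternating (suc i) afterA (xs ++ suc i ∷ i ∷ suc i ∷ ys)
alternating⇒¬braid i []       ys (low (other _ _ (other 1+i≢1+i _ _))) = 1+i≢1+i refl
alternating⇒¬braid i []       ys (other 1+i≢1+i _ _)                  = 1+i≢1+i refl
alternating⇒¬braid i (_ ∷ xs) ys (low w)         = alternating⇒¬braid i xs ys w
alternating⇒¬braid i (_ ∷ xs) ys (high w)        = alternating⇒¬braid i xs ys w
alternating⇒¬braid i (_ ∷ xs) ys (other _ _ w)   = alternating⇒¬braid i xs ys w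

canonical⇒Cond3 : ∀ {w} → Canonical w → Cond3 w
canonical⇒Cond3 canonical v w~v (xs , i , ys , refl) =
  alternating⇒¬braid i xs ys (alternating-CommEquiv w~v (runForm⇒alternating (suc i) false canonical z≤n tt))

HasHiddenBraid : List ℕ → Set
HasHiddenBraid w = ∃[ xs ] ∃[ i ] ∃[ R ] ∃[ ys ] All (_< i) R × w ≡ xs ++ suc i ∷ i ∷ R ++ suc i ∷ ys

run : ℕ → ℕ → List ℕ
run j m = applyDownFrom (_+ j) (suc m)

run-∷ʳ : ∀ j m → run (suc j) m ∷ʳ j ≡ run j (suc m)
run-∷ʳ j zero    = refl
run-∷ʳ j (suc m) = cong₂ _∷_ (cong suc (+-suc m j)) (run-∷ʳ j m)

run-last : ∀ j m → ∃[ Q ] run j m ≡ Q ∷ʳ j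
run-last j zero    = [] , refl
run-last j (suc m) = run (suc j) m , sym (run-∷ʳ j m)

run-split : ∀ {j i} m → j ≤ i → i < m + j → ∃[ T ] ∃[ R ] run j m ≡ T ++ suc i ∷ i ∷ R × All (_< i) R
run-split zero j≤i i<j = ⊥-elim (<⇒≱ i<j j≤i)
run-split {j} {i} (suc m) j≤i i<1+m+j with i ≟ m + j
... | yes refl = [] , applyDownFrom (_+ j) m , refl , applyDownFrom⁺₁ (_+ j) m (+-monoˡ-< j)
... | no i≢m+j with run-split m j≤i (≤∧≢⇒< (≤-pred i<1+m+j) i≢m+j)
...   | T , R , run≡ , R<i = (suc m + j) ∷ T , R , cong (suc m + j ∷_) run≡ , R<i

data Position (j t : ℕ) : ℕ → Set where
  farBelow  : ∀ {x} → suc x < j → Position j t x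
  justBelow : ∀ {x} → suc x ≡ j → Position j t x
  repeat    : ∀ {x} → x ≡ j → Position j t x
  inside    : ∀ {i} → j ≤ i → i < t → Position j t (suc i)
  above     : ∀ {x} → t < x → Position j t x

position : ∀ j t x → Position j t x
position j t x with <-cmp x j
... | tri< x<j _ _ with m≤n⇒m<n∨m≡n x<j
...   | inj₁ 1+x<j = farBelow 1+x<j
...   | inj₂ 1+x≡j = justBelow 1+x≡j
position j t x       | tri≈ _ x≡j _ = repeat x≡j
position j t (suc i) | tri> _ _ (s≤s j≤i) with t <? suc i
... | yes t<1+i = above t<1+i
... | no  t≮1+i = inside j≤i (≮⇒≥ t≮1+i)

module _ {W : List ℕ} (cond1 : Cond1 W) (squarefree : ¬ HasSquare W) (no-hidden-braid : ¬ HasHiddenBraid W) where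

  private
    after-run : ∀ P j m {x w} → W ≡ P ++ run j m ++ x ∷ w → ∃[ Q ] W ≡ (P ++ Q) ++ j ∷ x ∷ w
    after-run P j m {x} {w} W≡ with run-last j m
    ... | Q , run≡ = Q , (begin
      W                              ≡⟨ W≡ ⟩
      P ++ run j m ++ x ∷ w          ≡⟨ cong (λ r → P ++ r ++ x ∷ w) run≡ ⟩
      P ++ (Q ∷ʳ j) ++ x ∷ w         ≡⟨ cong (P ++_) (∷ʳ-++ Q j (x ∷ w)) ⟩
      P ++ Q ++ j ∷ x ∷ w            ≡⟨ ++-assoc P Q _ ⟨
      (P ++ Q) ++ j ∷ x ∷ w          ∎)

    scan : ∀ P j m w → W ≡ P ++ run j m ++ w → RunForm (suc (m + j)) j w
    scan P j m []      _  = []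
    scan P j m (x ∷ w) W≡ with position j (m + j) x
    ... | farBelow 1+x<j with after-run P j m W≡
    ...   | Q , W≡′ = ⊥-elim (cond1 (P ++ Q) j x w W≡′ 1+x<j)
    scan P .(suc x) m (x ∷ w) W≡ | justBelow refl =
      subst (λ lo → RunForm lo (suc x) (x ∷ w)) (cong suc (sym (+-suc m x)))
            (continue (scan P x (suc m) w W≡′))
      where
      W≡′ : W ≡ P ++ run x (suc m) ++ w
      W≡′ = trans W≡ (cong (P ++_) (trans (sym (∷ʳ-++ (run (suc x) m) x w))
                                          (cong (_++ w) (run-∷ʳ x m))))
    scan P j m (x ∷ w) W≡ | repeat refl with after-run P j m W≡
    ... | Q , W≡′ = ⊥-elim (squarefree (P ++ Q , j , w , W≡′))
    scan P j m (suc i ∷ w) W≡ | inside j≤i i<t with run-split m j≤i i<t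
    ... | T , R , run≡ , R<i = ⊥-elim (no-hidden-braid (P ++ T , i , R , w , R<i , (begin
      W                                              ≡⟨ W≡ ⟩
      P ++ run j m ++ suc i ∷ w                      ≡⟨ cong (λ r → P ++ r ++ suc i ∷ w) run≡ ⟩
      P ++ (T ++ suc i ∷ i ∷ R) ++ suc i ∷ w         ≡⟨ cong (P ++_) (++-assoc T _ _) ⟩
      P ++ T ++ suc i ∷ i ∷ R ++ suc i ∷ w           ≡⟨ ++-assoc P T _ ⟨
      (P ++ T) ++ suc i ∷ i ∷ R ++ suc i ∷ w         ∎)))
    scan P j m (x ∷ w) W≡ | above t<x =
      newRun t<x (scan (P ++ run j m) x 0 w (trans W≡ (sym (++-assoc P (run j m) (x ∷ w)))))

    start : ∀ {w} → W ≡ w → Canonical w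
    start {[]}    _  = []
    start {x ∷ w} W≡ = newRun z≤n (scan [] x 0 w W≡)

  conditions⇒canonical : Canonical W
  conditions⇒canonical = start refl

-- Lexicographically first reduced words

Lex≤-¬descent : ∀ xs {a b ys zs} → b < a → ¬ Lex≤ (xs ++ a ∷ ys) (xs ++ b ∷ zs)
Lex≤-¬descent []       b<a (lex-< a<b) = <-asym a<b b<a
Lex≤-¬descent []       b<a (lex-≡ _)   = <-irrefl refl b<a
Lex≤-¬descent (_ ∷ xs) b<a (lex-< x<x) = <-irrefl refl x<x
Lex≤-¬descent (_ ∷ xs) b<a (lex-≡ lex) = Lex≤-¬descent xs b<a lex

eval-commute-past : ∀ {c} R z → All (λ y → Far y c) R → eval R (swapAdj c z) ≡ swapAdj c (eval R z)
eval-commute-past []      z []            = refl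
eval-commute-past (y ∷ R) z (far ∷ R-far) =
  trans (cong (swapAdj y) (eval-commute-past R z R-far)) (swapAdj-comm-far far (eval R z))

commute-past : ∀ A R c B → All (λ y → Far y c) R → CommEquiv (A ++ R ++ c ∷ B) (A ++ c ∷ R ++ B)
commute-past A []      c B []            = ε
commute-past A (y ∷ R) c B (far ∷ R-far) =
  subst₂ CommEquiv (++-assoc A (y ∷ []) (R ++ c ∷ B)) (++-assoc A (y ∷ []) (c ∷ R ++ B))
         (commute-past (A ++ y ∷ []) R c B R-far)
  ◅◅ (comm A y c (R ++ B) far ◅ ε)

below⇒Far-suc : ∀ {i R} → All (_< i) R → All (λ y → Far y (suc i)) R
below⇒Far-suc = All.map (inj₁ ∘ s≤s)

Cond3⇒¬HasHiddenBraid : ∀ {w} → Cond3 w → ¬ HasHiddenBraid w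
Cond3⇒¬HasHiddenBraid cond3 (A , i , R , B , R<i , refl) =
  cond3 _ (subst₂ CommEquiv (++-assoc A (suc i ∷ i ∷ []) (R ++ suc i ∷ B))
                            (++-assoc A (suc i ∷ i ∷ []) (suc i ∷ R ++ B))
                            (commute-past (A ++ suc i ∷ i ∷ []) R (suc i) B (below⇒Far-suc R<i)))
        (A , i , R ++ B , refl)

module _ {n : ℕ} {π : Permutation′ n} {w : List ℕ} (lexFirst : LexFirst n π w) where

  private
    reduced : Reduced n π w
    reduced = proj₁ lexFirst
    least : ∀ v → Reduced n π v → Lex≤ w v
    least = proj₂ lexFirst

  lexFirst⇒Cond1 : Cond1 w
  lexFirst⇒Cond1 xs j i ys refl 1+i<j =
    Lex≤-¬descent xs (<-trans (n<1+n i) 1+i<j)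
      (least (xs ++ i ∷ j ∷ ys) (reduced-replace-suffix {n} {π} xs (j ∷ i ∷ ys) (i ∷ j ∷ ys) reduced
        (λ { (1+j<n ∷ 1+i<n ∷ valid) → 1+i<n ∷ 1+j<n ∷ valid })
        (λ z → swapAdj-comm-far (inj₂ 1+i<j) (eval ys z)) refl))

  lexFirst⇒¬HasHiddenBraid : ¬ HasHiddenBraid w
  lexFirst⇒¬HasHiddenBraid (A , i , R , B , R<i , refl) =
    Lex≤-¬descent A (n<1+n i)
      (least (A ++ i ∷ suc i ∷ i ∷ R ++ B)
        (reduced-replace-suffix {n} {π} A _ _ reduced valid-braided same-braided |braided|))
    where
    valid-braided : ValidWord n (suc i ∷ i ∷ R ++ suc i ∷ B) → ValidWord n (i ∷ suc i ∷ i ∷ R ++ B)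
    valid-braided (2+i<n ∷ 1+i<n ∷ valid) with ++⁻ R valid
    ... | valid-R , _ ∷ valid-B = 1+i<n ∷ 2+i<n ∷ 1+i<n ∷ ++⁺ valid-R valid-B
    same-braided : ∀ z → eval (suc i ∷ i ∷ R ++ suc i ∷ B) z ≡ eval (i ∷ suc i ∷ i ∷ R ++ B) z
    same-braided z = begin
      swapAdj (suc i) (swapAdj i (eval (R ++ suc i ∷ B) z))      ≡⟨ cong (swapAdj (suc i) ∘ swapAdj i) (eval-++ R (suc i ∷ B) z) ⟩
      swapAdj (suc i) (swapAdj i (eval R (swapAdj (suc i) (eval B z))))
        ≡⟨ cong (swapAdj (suc i) ∘ swapAdj i) (eval-commute-past R (eval B z) (below⇒Far-suc R<i)) ⟩
      swapAdj (suc i) (swapAdj i (swapAdj (suc i) (eval R (eval B z))))  ≡⟨ swapAdj-braid i (eval R (eval B z)) ⟩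
      swapAdj i (swapAdj (suc i) (swapAdj i (eval R (eval B z))))        ≡⟨ cong (swapAdj i ∘ swapAdj (suc i) ∘ swapAdj i) (eval-++ R B z) ⟨
      swapAdj i (swapAdj (suc i) (swapAdj i (eval (R ++ B) z)))          ∎
    |braided| : length (suc i ∷ i ∷ R ++ suc i ∷ B) ≡ length (i ∷ suc i ∷ i ∷ R ++ B)
    |braided| = cong (suc ∘ suc)
      (trans (length-++ R) (trans (+-suc (length R) _) (cong suc (sym (length-++ R)))))

Cond3⇒Cond2 : ∀ {w} → Cond3 w → Cond2 w
Cond3⇒Cond2 {w} cond3 = cond3 w ε

canonical⇒conditions : ∀ {w} → Canonical w → Cond1 w × Cond2 w × Cond3 w
canonical⇒conditions canonical =
  canonical⇒Cond1 canonical , Cond3⇒Cond2 (canonical⇒Cond3 canonical) , canonical⇒Cond3 canonical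

canonical⇒lexFirst : ∀ {n π w} → Reduced n π w → Canonical w → LexFirst n π w
canonical⇒lexFirst {n} {π} reduced canonical =
  reduced , λ v reduced-v →
    canonical⇒lex≤ canonical (reduced⇒isReduced {n} {π} reduced) (reduced⇒isReduced {n} {π} reduced-v)
                   (expresses⇒SamePerm {n} {π} (proj₁ reduced) (proj₁ reduced-v))

corollary5p3 : (n : ℕ) (π : Permutation′ n) (w : List ℕ) → Reduced n π w →
                 (LexFirst n π w ⇔ (Cond1 w × Cond2 w × Cond3 w))
corollary5p3 n π w reduced = mk⇔ to from
  where
  to : LexFirst n π w → Cond1 w × Cond2 w × Cond3 w
  to lexFirst = canonical⇒conditions (conditions⇒canonical
    (lexFirst⇒Cond1 {n} {π} lexFirst) (reduced⇒¬HasSquare {n} {π} reduced)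
    (lexFirst⇒¬HasHiddenBraid {n} {π} lexFirst))
  from : Cond1 w × Cond2 w × Cond3 w → LexFirst n π w
  from (cond1 , _ , cond3) = canonical⇒lexFirst {n} {π} reduced (conditions⇒canonical
    cond1 (reduced⇒¬HasSquare {n} {π} reduced) (Cond3⇒¬HasHiddenBraid cond3))
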